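{- Every finite tree with $s\ge 2$ leaves and diameter $d$ has at most $\tfrac{sd}{2}+1$ vertices.
   Context: The diameter of a tree is the length (number of edges) of a longest path in the tree. -}

module Defs where

open import Data.Nat using (ℕ; zero; suc; _≤_; _+_; _*_)
open import Data.Nat.Properties using (_≟_)
open import Data.Fin using (Fin; zero; suc; inject₁; fromℕ)
open import Data.Bool using (Bool; true; false; T; if_then_else_)
open import Data.List using (List; length; filter; map; allFin)
open import Data.Nat.ListAction using (sum)
open import Data.Product using (Σ; _×_; ∃)
open import Relation.Binary.PropositionalEquality using (_≡_)
open import Relation.Nullary using (¬_)

record SimpleGraph (n : ℕ) : Set where
  field
    adj   : Fin n → Fin n → Bool
    sym   : ∀ u v → adj u v ≡ adj v u
    irrefl : ∀ v → adj v v ≡ false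

module _ {n : ℕ} (G : SimpleGraph n) where
  open SimpleGraph G

  Adj : Fin n → Fin n → Set
  Adj u v = T (adj u v)

  IsPath : (k : ℕ) → (Fin (suc k) → Fin n) → Set
  IsPath k p = (∀ (i : Fin k) → Adj (p (inject₁ i)) (p (suc i)))
             × (∀ i j → p i ≡ p j → i ≡ j)

  PathOfLength : ℕ → Fin n → Fin n → Set
  PathOfLength k u v = Σ (Fin (suc k) → Fin n) λ p →
    IsPath k p × p zero ≡ u × p (fromℕ k) ≡ v

  Connected : Set
  Connected = ∀ u v → ∃ λ k → PathOfLength k u v

  HasCycle : Set
  HasCycle = Σ ℕ λ k → Σ (Fin (suc k) → Fin n) λ p →
    2 ≤ k × IsPath k p × Adj (p (fromℕ k)) (p zero)

  IsTree : Set
  IsTree = Connected × ¬ HasCycle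

  degree : Fin n → ℕ
  degree v = sum (map (λ w → if adj v w then 1 else 0) (allFin n))

  numLeaves : ℕ
  numLeaves = length (filter (λ v → degree v ≟ 1) (allFin n))

  HasDiameter : ℕ → Set
  HasDiameter d = (∃ λ u → ∃ λ v → PathOfLength d u v)
                × (∀ k u v → PathOfLength k u v → k ≤ d)

module Submission where

open import Defs
open import Data.Nat using (ℕ; zero; suc; _≤_; _<_; _+_; _*_; _∸_; z≤n; s≤s; _≤?_; _<?_)
open import Data.Nat.Properties
open import Data.Nat.Tactic.RingSolver using (solve)
open import Data.Nat.ListAction using (sum)
open import Data.Fin using (Fin; zero; suc; toℕ; fromℕ; fromℕ<; inject₁; join; splitAt; combine; remQuot)
  renaming (_≟_ to _≟F_)
open import Data.Fin.Properties
  using (toℕ-injective; toℕ<n; toℕ-fromℕ; toℕ-fromℕ<; toℕ-inject₁; any?; injective⇒≤;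
         splitAt-↑ˡ; splitAt-↑ʳ; remQuot-combine)
  renaming (suc-injective to Fin-suc-injective; 0≢1+n to zero≢suc)
open import Data.Bool using (Bool; true; false; T; _∧_; _∨_; if_then_else_)
open import Data.Bool.Properties using (T-≡; T-∧; T-∨; ¬-not)
open import Data.List using (List; []; _∷_; length; filter; allFin; tabulate; lookup)
open import Data.List.Properties using (map-tabulate)
open import Data.List.Membership.Propositional using (_∈_; _∉_)
open import Data.List.Membership.Propositional.Properties using (∈-filter⁺; ∈-allFin)
import Data.List.Membership.DecPropositional as DecMembership
open import Data.List.Relation.Unary.Any using (here; there; index)
open import Data.List.Relation.Unary.Any.Properties using (lookup-index)
open import Data.Product using (Σ; _×_; _,_; proj₁; proj₂; ∃; uncurry)
open import Data.Sum using (_⊎_; inj₁; inj₂; map₂)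
open import Data.Sum.Properties using (inj₁-injective; inj₂-injective)
open import Data.Product.Properties using (,-injectiveˡ; ,-injectiveʳ)
open import Data.Empty using (⊥; ⊥-elim)
open import Relation.Binary.PropositionalEquality
open import Relation.Nullary using (¬_; Dec; yes; no)
open import Relation.Nullary.Decidable using (⌊_⌋; toWitness; fromWitness; T?; _×-dec_; _⊎-dec_; ¬?)
open import Relation.Binary.Definitions using (tri<; tri≈; tri>)
open import Function using (_∘_)
open import Function.Bundles using (Equivalence)

-- Root the tree at a vertex c.  Walking down from a non-root vertex v through children
-- ends at a leaf, and v is the unique ancestor of that leaf at depth (depth v); so v is
-- determined by a pair (leaf, depth).  Hence if all depths are ≤ h then n ≤ 1 + s·h
-- (count-by-depth), and if only the branch of one child z of c reaches depth R + 1 while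
-- all depths are ≤ R + 1 then n ≤ 2 + s·R (count-split).  We reach one of these cases by
-- walking towards a centre (Descent): if the eccentricity R + 1 of c is attained at x in
-- the branch of z, then either another branch also reaches depth R + 1, giving a path of
-- length 2R + 2 through c (central case), or another branch reaches depth R, giving a path
-- of length 2R + 1 (bicentral case, where s ≥ 2 is used), or else z has eccentricity ≤ R
-- and we continue from z.

search : (ℕ → Bool) → ℕ → ℕ → ℕ
search f i zero    = i
search f i (suc m) = if f i then i else search f (suc i) m

search-least : ∀ (f : ℕ → Bool) i m k → i ≤ k → T (f k) → search f i m ≤ k
search-least f i zero    k i≤k fk = i≤k
search-least f i (suc m) k i≤k fk with f i in eq
... | true  = i≤k
... | false = search-least f (suc i) m k (≤∧≢⇒< i≤k i≢k) fk
  where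
  i≢k : i ≢ k
  i≢k refl = subst T eq fk

search-holds : ∀ (f : ℕ → Bool) i m → T (f (m + i)) → T (f (search f i m))
search-holds f i zero    h = h
search-holds f i (suc m) h with f i in eq
... | true  = subst T (sym eq) _
... | false = search-holds f (suc i) m (subst (T ∘ f) (sym (+-suc m i)) h)

count-by-code : ∀ {n e L K} (code : Fin n → Fin e ⊎ (Fin L × Fin K)) →
                (∀ {v w} → code v ≡ code w → v ≡ w) → n ≤ e + L * K
count-by-code {e = e} {L} {K} code code-inj =
  injective⇒≤ {f = flatten ∘ code} (code-inj ∘ flatten-injective)
  where
  flatten : Fin e ⊎ (Fin L × Fin K) → Fin (e + L * K)
  flatten = join e (L * K) ∘ map₂ (uncurry combine)

  unflatten : Fin (e + L * K) → Fin e ⊎ (Fin L × Fin K)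
  unflatten = map₂ (remQuot K) ∘ splitAt e

  retract : ∀ x → unflatten (flatten x) ≡ x
  retract (inj₁ i)       = cong (map₂ (remQuot K)) (splitAt-↑ˡ e i (L * K))
  retract (inj₂ (i , j)) = trans (cong (map₂ (remQuot K)) (splitAt-↑ʳ e (L * K) (combine i j)))
                                 (cong inj₂ (remQuot-combine i j))

  flatten-injective : ∀ {x y} → flatten x ≡ flatten y → x ≡ y
  flatten-injective {x} {y} eq = trans (sym (retract x)) (trans (cong unflatten eq) (retract y))

index-injective : ∀ {A : Set} {xs : List A} {x y : A} (p : x ∈ xs) (q : y ∈ xs) →
                  index p ≡ index q → x ≡ y
index-injective {xs = xs} p q eq =
  trans (lookup-index p) (trans (cong (lookup xs) eq) (sym (lookup-index q)))

count-by-pairs : ∀ {n} (es as : List (Fin n)) (K : ℕ) (a : Fin n → Fin n) (b : Fin n → ℕ) →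
                 (∀ v → v ∉ es → a v ∈ as × b v < K) →
                 (∀ v w → v ∉ es → w ∉ es → a v ≡ a w → b v ≡ b w → v ≡ w) →
                 n ≤ length es + length as * K
count-by-pairs {n} es as K a b fits separates = count-by-code encode encode-inj
  where
  open DecMembership (_≟F_ {n}) using (_∈?_)

  code : ∀ v → Dec (v ∈ es) → Fin (length es) ⊎ (Fin (length as) × Fin K)
  code v (yes v∈) = inj₁ (index v∈)
  code v (no v∉)  = inj₂ (index (proj₁ (fits v v∉)) , fromℕ< (proj₂ (fits v v∉)))

  encode : Fin n → Fin (length es) ⊎ (Fin (length as) × Fin K)
  encode v = code v (v ∈? es)

  encode-inj : ∀ {v w} → encode v ≡ encode w → v ≡ w
  encode-inj {v} {w} = by-cases (v ∈? es) (w ∈? es)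
    where
    by-cases : ∀ dv dw → code v dv ≡ code w dw → v ≡ w
    by-cases (yes p) (yes q) eq = index-injective p q (inj₁-injective eq)
    by-cases (no p)  (no q)  eq = separates v w p q
      (index-injective (proj₁ (fits v p)) (proj₁ (fits w q)) (,-injectiveˡ (inj₂-injective eq)))
      (trans (sym (toℕ-fromℕ< (proj₂ (fits v p))))
             (trans (cong toℕ (,-injectiveʳ (inj₂-injective eq))) (toℕ-fromℕ< (proj₂ (fits w q)))))
    by-cases (yes _) (no _)  ()
    by-cases (no _)  (yes _) ()

indicator : ∀ {m} → (Fin m → Bool) → Fin m → ℕ
indicator g w = if g w then 1 else 0

none-selected : ∀ {m} (g : Fin m → Bool) → (∀ w → g w ≡ false) → sum (tabulate (indicator g)) ≡ 0
none-selected {zero}  g none = refl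
none-selected {suc m} g none rewrite none zero = none-selected (g ∘ suc) (none ∘ suc)

one-selected : ∀ {m} (g : Fin m → Bool) u → g u ≡ true → (∀ w → g w ≡ true → w ≡ u) →
               sum (tabulate (indicator g)) ≡ 1
one-selected {suc m} g zero gu unique rewrite gu =
  cong suc (none-selected (g ∘ suc) (λ w → ¬-not (λ e → zero≢suc (sym (unique (suc w) e)))))
one-selected {suc m} g (suc u) gu unique rewrite ¬-not {g zero} (λ e → zero≢suc (unique zero e)) =
  one-selected (g ∘ suc) u gu (λ w e → Fin-suc-injective (unique (suc w) e))

central-bound : ∀ {n L h d} → n ≤ 1 + L * h → h + h ≤ d → 2 * n ≤ L * d + 2
central-bound {n} {L} {h} {d} n≤ 2h≤d = begin
  2 * n            ≤⟨ *-monoʳ-≤ 2 n≤ ⟩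
  2 * (1 + L * h)  ≡⟨ solve (L ∷ h ∷ []) ⟩
  L * (h + h) + 2  ≤⟨ +-monoˡ-≤ 2 (*-monoʳ-≤ L 2h≤d) ⟩
  L * d + 2        ∎
  where open ≤-Reasoning

bicentral-bound : ∀ {n L R d} → 2 ≤ L → n ≤ 2 + L * R → suc R + R ≤ d → 2 * n ≤ L * d + 2
bicentral-bound {n} {L} {R} {d} 2≤L n≤ 2R+1≤d = begin
  2 * n                  ≤⟨ *-monoʳ-≤ 2 n≤ ⟩
  2 * (2 + L * R)        ≡⟨ solve (L ∷ R ∷ []) ⟩
  L * (R + R) + (2 + 2)  ≤⟨ +-monoʳ-≤ (L * (R + R)) (+-monoˡ-≤ 2 2≤L) ⟩
  L * (R + R) + (L + 2)  ≡⟨ solve (L ∷ R ∷ []) ⟩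
  L * (suc R + R) + 2    ≤⟨ +-monoˡ-≤ 2 (*-monoʳ-≤ L 2R+1≤d) ⟩
  L * d + 2              ∎
  where open ≤-Reasoning

module Tree {n : ℕ} (G : SimpleGraph n) (conn : Connected G) (acyclic : ¬ HasCycle G) where
  open SimpleGraph G using (adj)

  V : Set
  V = Fin n

  infix 4 _~_
  _~_ : V → V → Set
  _~_ = Adj G

  ~-sym : ∀ {u v} → u ~ v → v ~ u
  ~-sym {u} {v} = subst T (SimpleGraph.sym G u v)

  ~-irrefl : ∀ {u v} → u ~ v → u ≢ v
  ~-irrefl {u} u~u refl = subst T (SimpleGraph.irrefl G u) u~u

  -- This is easier to cut and glue than the Fin-indexed IsPath of Defs.
  Path : ℕ → (ℕ → V) → Set
  Path k q = (∀ j → j < k → q j ~ q (suc j)) × (∀ j l → j ≤ k → l ≤ k → q j ≡ q l → j ≡ l)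

  Path⇒IsPath : ∀ {k q} → Path k q → IsPath G k (q ∘ toℕ)
  Path⇒IsPath {k} {q} (steps , distinct) =
    (λ i → subst (λ j → q j ~ q (suc (toℕ i))) (sym (toℕ-inject₁ i)) (steps (toℕ i) (toℕ<n i))) ,
    (λ i j eq → toℕ-injective (distinct _ _ (≤-pred (toℕ<n i)) (≤-pred (toℕ<n j)) eq))

  Path⇒PathOfLength : ∀ {k q} → Path k q → PathOfLength G k (q 0) (q k)
  Path⇒PathOfLength {k} {q} p = q ∘ toℕ , Path⇒IsPath p , refl , cong q (toℕ-fromℕ k)

  no-closed-path : ∀ {k q} → 2 ≤ k → Path k q → q k ~ q 0 → ⊥
  no-closed-path {k} {q} 2≤k p closing = acyclic
    (k , q ∘ toℕ , 2≤k , Path⇒IsPath p , subst (λ j → q j ~ q 0) (sym (toℕ-fromℕ k)) closing)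

  reverse-path : ∀ {k q} → Path k q → Path k (λ j → q (k ∸ j))
  reverse-path {k} {q} (steps , distinct) =
    steps′ , (λ j l j≤k l≤k eq → ∸-cancelˡ-≡ j≤k l≤k (distinct _ _ (m∸n≤m k j) (m∸n≤m k l) eq))
    where
    steps′ : ∀ j → j < k → q (k ∸ j) ~ q (k ∸ suc j)
    steps′ j j<k = subst (λ i → q i ~ q (k ∸ suc j)) (sym (+-∸-assoc 1 j<k))
                         (~-sym (steps (k ∸ suc j) (∸-monoʳ-< (s≤s z≤n) j<k)))

  prepend : V → (ℕ → V) → ℕ → V
  prepend x q zero    = x
  prepend x q (suc j) = q j

  prepend-path : ∀ {k q x} → Path k q → x ~ q 0 → (∀ j → j ≤ k → q j ≢ x) → Path (suc k) (prepend x q)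
  prepend-path {k} {q} {x} (steps , distinct) x~q0 fresh = steps′ , distinct′
    where
    steps′ : ∀ j → j < suc k → prepend x q j ~ prepend x q (suc j)
    steps′ zero    _   = x~q0
    steps′ (suc j) j<k = steps j (≤-pred j<k)

    distinct′ : ∀ j l → j ≤ suc k → l ≤ suc k → prepend x q j ≡ prepend x q l → j ≡ l
    distinct′ zero    zero    _   _   _  = refl
    distinct′ zero    (suc l) _   l≤k eq = ⊥-elim (fresh l (≤-pred l≤k) (sym eq))
    distinct′ (suc j) zero    j≤k _   eq = ⊥-elim (fresh j (≤-pred j≤k) eq)
    distinct′ (suc j) (suc l) j≤k l≤k eq = cong suc (distinct j l (≤-pred j≤k) (≤-pred l≤k) eq)

  module Concat (i i' : ℕ) (p q : ℕ → V) where
    concat : ℕ → V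
    concat j with j ≤? i
    ... | yes _ = p j
    ... | no _  = q (j ∸ i)

    concat-ˡ : ∀ j → j ≤ i → concat j ≡ p j
    concat-ˡ j j≤i with j ≤? i
    ... | yes _   = refl
    ... | no j≰i  = ⊥-elim (j≰i j≤i)

    concat-ʳ : p i ≡ q 0 → ∀ j → i ≤ j → concat j ≡ q (j ∸ i)
    concat-ʳ glue j i≤j with j ≤? i
    ... | no _    = refl
    ... | yes j≤i rewrite ≤-antisym j≤i i≤j | n∸n≡0 i = glue

    tail-bound : ∀ j → j ≤ i + i' → j ∸ i ≤ i'
    tail-bound j j≤ = subst (j ∸ i ≤_) (m+n∸m≡n i i') (∸-monoˡ-≤ i j≤)

    concat-path : Path i p → Path i' q → p i ≡ q 0 →
                  (∀ a b → a ≤ i → b ≤ i' → p a ≡ q b → b ≡ 0) → Path (i + i') concat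
    concat-path (steps₁ , distinct₁) (steps₂ , distinct₂) glue meets = steps , distinct
      where
      steps : ∀ j → j < i + i' → concat j ~ concat (suc j)
      steps j j< = by-cases (suc j ≤? i)
        where
        by-cases : Dec (suc j ≤ i) → concat j ~ concat (suc j)
        by-cases (yes sj≤i) =
          subst₂ _~_ (sym (concat-ˡ j (≤-trans (n≤1+n j) sj≤i))) (sym (concat-ˡ (suc j) sj≤i)) (steps₁ j sj≤i)
        by-cases (no sj≰i) =
          subst₂ _~_ (sym (concat-ʳ glue j i≤j))
                     (sym (trans (concat-ʳ glue (suc j) (≤-trans i≤j (n≤1+n j))) (cong q (+-∸-assoc 1 i≤j))))
                     (steps₂ (j ∸ i) (subst (j ∸ i <_) (m+n∸m≡n i i') (∸-monoˡ-< j< i≤j)))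
          where
          i≤j : i ≤ j
          i≤j = ≤-pred (≰⇒> sj≰i)

      crossing : ∀ j l → j ≤ i → i < l → l ≤ i + i' → concat j ≢ concat l
      crossing j l j≤i i<l l≤ eq =
        m<n⇒n≢0 (m<n⇒0<n∸m i<l)
          (meets j (l ∸ i) j≤i (tail-bound l l≤) (trans (sym (concat-ˡ j j≤i)) (trans eq (concat-ʳ glue l (<⇒≤ i<l)))))

      distinct : ∀ j l → j ≤ i + i' → l ≤ i + i' → concat j ≡ concat l → j ≡ l
      distinct j l j≤ l≤ eq = by-cases (j ≤? i) (l ≤? i)
        where
        by-cases : Dec (j ≤ i) → Dec (l ≤ i) → j ≡ l
        by-cases (yes j≤i) (yes l≤i) =
          distinct₁ j l j≤i l≤i (trans (sym (concat-ˡ j j≤i)) (trans eq (concat-ˡ l l≤i)))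
        by-cases (yes j≤i) (no l≰i)  = ⊥-elim (crossing j l j≤i (≰⇒> l≰i) l≤ eq)
        by-cases (no j≰i)  (yes l≤i) = ⊥-elim (crossing l j l≤i (≰⇒> j≰i) j≤ (sym eq))
        by-cases (no j≰i)  (no l≰i)  = ∸-cancelʳ-≡ i≤j i≤l
          (distinct₂ _ _ (tail-bound j j≤) (tail-bound l l≤)
            (trans (sym (concat-ʳ glue j i≤j)) (trans eq (concat-ʳ glue l i≤l))))
          where
          i≤j : i ≤ j
          i≤j = <⇒≤ (≰⇒> j≰i)
          i≤l : i ≤ l
          i≤l = <⇒≤ (≰⇒> l≰i)

  IsLeaf : V → Set
  IsLeaf ℓ = degree G ℓ ≡ 1

  leaves : List V
  leaves = filter (λ v → degree G v ≟ 1) (allFin n)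

  leaf∈leaves : ∀ {ℓ} → IsLeaf ℓ → ℓ ∈ leaves
  leaf∈leaves {ℓ} = ∈-filter⁺ (λ v → degree G v ≟ 1) (∈-allFin ℓ)

  choose : ∀ {P : V → Set} → Dec (∃ P) → V → V
  choose (yes (w , _)) _ = w
  choose (no _)        v = v

  choose-spec : ∀ {P : V → Set} (D : Dec (∃ P)) v → ∃ P → P (choose D v)
  choose-spec (yes (_ , pw)) _ _  = pw
  choose-spec (no none)      _ ex = ⊥-elim (none ex)

  module Rooted (c : V) where

    within : ℕ → V → Bool
    within zero    v = ⌊ v ≟F c ⌋
    within (suc k) v = within k v ∨ ⌊ any? (λ w → T? (adj v w ∧ within k w)) ⌋

    within-step : ∀ {k v w} → v ~ w → T (within k w) → T (within (suc k) v)
    within-step {k} {v} {w} v~w w-in = Equivalence.from (T-∨ {x = within k v}) (inj₂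
      (fromWitness {a? = any? (λ w → T? (adj v w ∧ within k w))} (w , Equivalence.from T-∧ (v~w , w-in))))

    within-suc : ∀ {k v} → T (within k v) → T (within (suc k) v)
    within-suc {k} {v} v-in = Equivalence.from
      (T-∨ {x = within k v} {y = ⌊ any? (λ w → T? (adj v w ∧ within k w)) ⌋}) (inj₁ v-in)

    within-+ : ∀ m {k v} → T (within k v) → T (within (m + k) v)
    within-+ zero    v-in = v-in
    within-+ (suc m) {k} v-in = within-suc {m + k} (within-+ m v-in)

    within-inv : ∀ {k v} → T (within (suc k) v) → T (within k v) ⊎ ∃ λ w → v ~ w × T (within k w)
    within-inv {k} {v} v-in with Equivalence.to (T-∨ {x = within k v}) v-in
    ... | inj₁ near = inj₁ near
    ... | inj₂ far  with toWitness {a? = any? (λ w → T? (adj v w ∧ within k w))} far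
    ...   | (w , both) = inj₂ (w , Equivalence.to T-∧ both)

    path-within : ∀ k (p : Fin (suc k) → V) → (∀ i → p (inject₁ i) ~ p (suc i)) →
                  p (fromℕ k) ≡ c → T (within k (p zero))
    path-within zero    p steps end = fromWitness end
    path-within (suc k) p steps end =
      within-step {k} (steps zero) (path-within k (p ∘ suc) (steps ∘ suc) end)

    -- By connectivity every vertex is within n steps of c (a path has ≤ n vertices).
    within-n : ∀ v → T (within n v)
    within-n v with conn v c
    ... | (k , p , (steps , distinct) , start , end) =
      subst (λ m → T (within m v)) (m∸n+n≡m k≤n)
        (within-+ (n ∸ k) (subst (T ∘ within k) start (path-within k p steps end)))
      where
      k≤n : k ≤ n
      k≤n = ≤-trans (n≤1+n k) (injective⇒≤ {f = p} (λ {i} {j} → distinct i j))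

    depth : V → ℕ
    depth v = search (λ k → within k v) 0 n

    depth-within : ∀ v → T (within (depth v) v)
    depth-within v = search-holds (λ k → within k v) 0 n
      (subst (λ m → T (within m v)) (sym (+-identityʳ n)) (within-n v))

    depth-least : ∀ {k} v → T (within k v) → depth v ≤ k
    depth-least {k} v = search-least (λ k → within k v) 0 n k z≤n

    depth≤n : ∀ v → depth v ≤ n
    depth≤n v = depth-least v (within-n v)

    depth-root : depth c ≡ 0
    depth-root = n≤0⇒n≡0 (depth-least c (fromWitness refl))

    depth≡0 : ∀ {v} → depth v ≡ 0 → v ≡ c
    depth≡0 {v} d≡0 = toWitness (subst (λ m → T (within m v)) d≡0 (depth-within v))

    nonroot-depth : ∀ {v} → v ≢ c → 1 ≤ depth v
    nonroot-depth v≢c = ≤∧≢⇒< z≤n (λ 0≡d → v≢c (depth≡0 (sym 0≡d)))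

    depth-~ : ∀ {u w} → u ~ w → depth u ≤ suc (depth w)
    depth-~ {u} {w} u~w = depth-least u (within-step {depth w} u~w (depth-within w))

    -- parent v: a neighbour of v one level closer to c (v itself for v = c).
    parent : V → V
    parent v = choose (any? (λ w → T? (adj v w ∧ within (depth v ∸ 1) w))) v

    parent-spec : ∀ v → 1 ≤ depth v → v ~ parent v × suc (depth (parent v)) ≡ depth v
    parent-spec v 1≤d = v~pv , ≤-antisym (≤-trans (s≤s (depth-least (parent v) pv-in)) (≤-reflexive d-1+1)) (depth-~ v~pv)
      where
      d-1+1 : suc (depth v ∸ 1) ≡ depth v
      d-1+1 = m+[n∸m]≡n 1≤d
      closer : ∃ λ w → T (adj v w ∧ within (depth v ∸ 1) w)
      closer with within-inv {depth v ∸ 1} (subst (λ m → T (within m v)) (sym d-1+1) (depth-within v))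
      ... | inj₁ near = ⊥-elim (<-irrefl refl (≤-trans (s≤s (depth-least v near)) (≤-reflexive d-1+1)))
      ... | inj₂ (w , v~w , w-in) = w , Equivalence.from T-∧ (v~w , w-in)
      chosen : T (adj v (parent v) ∧ within (depth v ∸ 1) (parent v))
      chosen = choose-spec (any? (λ w → T? (adj v w ∧ within (depth v ∸ 1) w))) v closer
      v~pv : v ~ parent v
      v~pv = proj₁ (Equivalence.to T-∧ chosen)
      pv-in : T (within (depth v ∸ 1) (parent v))
      pv-in = proj₂ (Equivalence.to T-∧ chosen)

    ancestor : ℕ → V → V
    ancestor zero    v = v
    ancestor (suc k) v = parent (ancestor k v)

    ancestor-depth : ∀ k v → k ≤ depth v → depth (ancestor k v) + k ≡ depth v
    ancestor-depth zero    v _   = +-identityʳ (depth v)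
    ancestor-depth (suc k) v k<d = begin
      depth (ancestor (suc k) v) + suc k     ≡⟨ +-suc _ k ⟩
      suc (depth (ancestor (suc k) v)) + k   ≡⟨ cong (_+ k) (proj₂ (parent-spec (ancestor k v) 1≤d)) ⟩
      depth (ancestor k v) + k               ≡⟨ previous ⟩
      depth v                                ∎
      where
      open ≡-Reasoning
      previous : depth (ancestor k v) + k ≡ depth v
      previous = ancestor-depth k v (≤-trans (n≤1+n k) k<d)
      1≤d : 1 ≤ depth (ancestor k v)
      1≤d = +-cancelʳ-≤ k 1 _ (subst (suc k ≤_) (sym previous) k<d)

    ancestor-depth-≤ : ∀ k v → k ≤ depth v → depth (ancestor k v) ≤ depth v
    ancestor-depth-≤ k v k≤d = subst (depth (ancestor k v) ≤_) (ancestor-depth k v k≤d) (m≤m+n _ k)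

    ancestor-~ : ∀ k v → k < depth v → ancestor k v ~ ancestor (suc k) v
    ancestor-~ k v k<d = proj₁ (parent-spec (ancestor k v)
      (+-cancelʳ-≤ k 1 _ (subst (suc k ≤_) (sym (ancestor-depth k v (<⇒≤ k<d))) k<d)))

    ancestor-root : ∀ v → ancestor (depth v) v ≡ c
    ancestor-root v = depth≡0 (+-cancelʳ-≡ (depth v) _ 0 (ancestor-depth (depth v) v ≤-refl))

    ancestor-injective : ∀ {a b} v → a ≤ depth v → b ≤ depth v → ancestor a v ≡ ancestor b v → a ≡ b
    ancestor-injective {a} {b} v a≤d b≤d eq = +-cancelˡ-≡ (depth (ancestor a v)) a b
      (trans (ancestor-depth a v a≤d) (trans (sym (ancestor-depth b v b≤d)) (cong (λ x → depth x + b) (sym eq))))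

    ancestor-+ : ∀ a b v → ancestor (a + b) v ≡ ancestor a (ancestor b v)
    ancestor-+ zero    b v = refl
    ancestor-+ (suc a) b v = cong parent (ancestor-+ a b v)

    ancestor-path : ∀ v i → i ≤ depth v → Path i (λ a → ancestor a v)
    ancestor-path v i i≤d =
      (λ a a<i → ancestor-~ a v (≤-trans a<i i≤d)) ,
      (λ a b a≤i b≤i → ancestor-injective v (≤-trans a≤i i≤d) (≤-trans b≤i i≤d))

    -- The "vee" from u up i steps to a common ancestor and down i' steps to u'.
    module Vee (u u' : V) (i i' : ℕ) where
      open Concat i i' (λ a → ancestor a u) (λ b → ancestor (i' ∸ b) u') public

      vee-path : i ≤ depth u → i' ≤ depth u' → ancestor i u ≡ ancestor i' u' →
                 (∀ a b → a < i → b < i' → ancestor a u ≢ ancestor b u') → Path (i + i') concat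
      vee-path i≤d i'≤d' top disjoint =
        concat-path (ancestor-path u i i≤d) (reverse-path (ancestor-path u' i' i'≤d')) top only-top
        where
        only-top : ∀ a b → a ≤ i → b ≤ i' → ancestor a u ≡ ancestor (i' ∸ b) u' → b ≡ 0
        only-top a b a≤i b≤i' eq with b ≟ 0 | a <? i
        ... | yes b≡0 | _       = b≡0
        ... | no b≢0  | yes a<i = ⊥-elim (disjoint a (i' ∸ b) a<i i'-b<i' eq)
          where
          i'-b<i' : i' ∸ b < i'
          i'-b<i' = ∸-monoʳ-< (n≢0⇒n>0 b≢0) b≤i'
        ... | no b≢0  | no a≮i  = ⊥-elim (<-irrefl i'-b≡i' (∸-monoʳ-< (n≢0⇒n>0 b≢0) b≤i'))
          where
          a≡i : a ≡ i
          a≡i = ≤-antisym a≤i (≮⇒≥ a≮i)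
          i'-b≡i' : i' ∸ b ≡ i'
          i'-b≡i' = ancestor-injective u' (≤-trans (m∸n≤m i' b) i'≤d') i'≤d'
                      (trans (sym eq) (trans (cong (λ x → ancestor x u) a≡i) top))

      vee-start : concat 0 ≡ u
      vee-start = concat-ˡ 0 z≤n

      vee-end : ancestor i u ≡ ancestor i' u' → concat (i + i') ≡ u'
      vee-end top = trans (concat-ʳ top (i + i') (m≤m+n i i'))
        (trans (cong (λ x → ancestor (i' ∸ x) u') (m+n∸m≡n i i')) (cong (λ x → ancestor x u') (n∸n≡0 i')))

      vee-depth : i ≤ depth u → i' ≤ depth u' → depth u ≡ depth u' → ancestor i u ≡ ancestor i' u' →
                  ∀ j → depth (concat j) ≤ depth u
      vee-depth i≤d i'≤d' same top j = by-cases (j ≤? i)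
        where
        by-cases : Dec (j ≤ i) → depth (concat j) ≤ depth u
        by-cases (yes j≤i) = subst (λ x → depth x ≤ depth u) (sym (concat-ˡ j j≤i))
          (ancestor-depth-≤ j u (≤-trans j≤i i≤d))
        by-cases (no j≰i)  = subst (λ x → depth x ≤ depth u) (sym (concat-ʳ top j (<⇒≤ (≰⇒> j≰i))))
          (subst (depth (ancestor (i' ∸ (j ∸ i)) u') ≤_) (sym same)
            (ancestor-depth-≤ (i' ∸ (j ∸ i)) u' (≤-trans (m∸n≤m i' (j ∸ i)) i'≤d')))

    Meet : V → V → Set
    Meet u u' = Σ ℕ λ i → 1 ≤ i × i ≤ depth u × ancestor i u ≡ ancestor i u' ×
                (∀ a b → a < i → b < i → ancestor a u ≢ ancestor b u')

    meet : ∀ {u u'} → u ≢ u' → depth u ≡ depth u' → Meet u u'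
    meet {u} {u'} u≢u' same = i , 1≤i , i≤d , met , disjoint
      where
      together : ℕ → Bool
      together k = ⌊ ancestor k u ≟F ancestor k u' ⌋

      i : ℕ
      i = search together 0 (depth u)

      at-root : ancestor (depth u) u ≡ ancestor (depth u) u'
      at-root = trans (ancestor-root u) (sym (subst (λ k → ancestor k u' ≡ c) (sym same) (ancestor-root u')))

      met : ancestor i u ≡ ancestor i u'
      met = toWitness (search-holds together 0 (depth u)
              (fromWitness (subst (λ k → ancestor k u ≡ ancestor k u') (sym (+-identityʳ (depth u))) at-root)))

      i≤d : i ≤ depth u
      i≤d = search-least together 0 (depth u) (depth u) z≤n (fromWitness at-root)

      1≤i : 1 ≤ i
      1≤i = ≤∧≢⇒< z≤n (λ 0≡i → u≢u' (subst (λ k → ancestor k u ≡ ancestor k u') (sym 0≡i) met))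

      disjoint : ∀ a b → a < i → b < i → ancestor a u ≢ ancestor b u'
      disjoint a b a<i b<i eq = <-irrefl refl
        (≤-<-trans (search-least together 0 (depth u) a z≤n (fromWitness (subst (λ x → ancestor a u ≡ ancestor x u') (sym a≡b) eq))) a<i)
        where
        a≡b : a ≡ b
        a≡b = +-cancelˡ-≡ (depth (ancestor a u)) a b
          (trans (ancestor-depth a u (≤-trans (<⇒≤ a<i) i≤d))
          (trans same
          (trans (sym (ancestor-depth b u' (≤-trans (<⇒≤ b<i) (≤-trans i≤d (≤-reflexive same)))))
                 (cong (λ x → depth x + b) (sym eq)))))

    -- No edge joins two vertices of equal depth: with the vee between them it would close a cycle.
    level-edge-free : ∀ {u u'} → u ~ u' → depth u ≢ depth u'
    level-edge-free {u} {u'} u~u' same with meet (~-irrefl u~u') same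
    ... | (i , 1≤i , i≤d , met , disjoint) =
      no-closed-path (+-mono-≤ 1≤i 1≤i) (vee-path i≤d (≤-trans i≤d (≤-reflexive same)) met disjoint)
        (subst₂ _~_ (sym (vee-end met)) (sym vee-start) (~-sym u~u'))
      where open Vee u u' i i

    -- A vertex has only one neighbour one level closer to c: two of them, with the
    -- vee between them, would close a cycle through x.
    lower-neighbour-unique : ∀ {x u u'} → x ~ u → x ~ u' → depth x ≡ suc (depth u) → depth u ≡ depth u' → u ≡ u'
    lower-neighbour-unique {x} {u} {u'} x~u x~u' dx same with u ≟F u'
    ... | yes u≡u' = u≡u'
    ... | no u≢u' with meet u≢u' same
    ...   | (i , 1≤i , i≤d , met , disjoint) = ⊥-elim
      (no-closed-path (s≤s (≤-trans 1≤i (m≤m+n i i))) (prepend-path vee x~start below-x)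
        (subst (λ y → y ~ x) (sym (vee-end met)) (~-sym x~u')))
      where
      open Vee u u' i i
      i≤d' : i ≤ depth u'
      i≤d' = ≤-trans i≤d (≤-reflexive same)
      vee : Path (i + i) concat
      vee = vee-path i≤d i≤d' met disjoint
      x~start : x ~ concat 0
      x~start = subst (x ~_) (sym vee-start) x~u
      below-x : ∀ j → j ≤ i + i → concat j ≢ x
      below-x j _ eq = <-irrefl refl (begin-strict
        depth x                 ≡⟨ cong depth (sym eq) ⟩
        depth (concat j)        ≤⟨ vee-depth i≤d i≤d' same met j ⟩
        depth u                 <⟨ n<1+n (depth u) ⟩
        suc (depth u)           ≡⟨ sym dx ⟩
        depth x                 ∎)
        where open ≤-Reasoning

    parent-unique : ∀ {x u} → x ~ u → depth x ≡ suc (depth u) → parent x ≡ u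
    parent-unique {x} {u} x~u dx = sym (lower-neighbour-unique x~u (proj₁ spec) dx
      (suc-injective (trans (sym dx) (sym (proj₂ spec)))))
      where
      spec : x ~ parent x × suc (depth (parent x)) ≡ depth x
      spec = parent-spec x (subst (1 ≤_) (sym dx) (s≤s z≤n))

    Child : V → V → Set
    Child v w = 1 ≤ depth w × parent w ≡ v

    child? : ∀ v w → Dec (Child v w)
    child? v w = (1 ≤? depth w) ×-dec (parent w ≟F v)

    child-depth : ∀ {v w} → Child v w → depth w ≡ suc (depth v)
    child-depth {v} {w} (1≤d , pw≡v) = trans (sym (proj₂ (parent-spec w 1≤d))) (cong (suc ∘ depth) pw≡v)

    neighbour-is-child : ∀ {v w} → v ~ w → 1 ≤ depth v → parent v ≢ w → Child v w
    neighbour-is-child {v} {w} v~w 1≤dv pv≢w with <-cmp (depth v) (depth w)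
    ... | tri≈ _ same _ = ⊥-elim (level-edge-free v~w same)
    ... | tri< dv<dw _ _ = ≤-trans (s≤s z≤n) dv<dw , parent-unique (~-sym v~w) (≤-antisym (depth-~ (~-sym v~w)) dv<dw)
    ... | tri> _ _ dw<dv = ⊥-elim (pv≢w (parent-unique v~w (≤-antisym (depth-~ v~w) dw<dv)))

    -- A childless non-root vertex is a leaf: its parent is its only neighbour.
    childless-leaf : ∀ v → 1 ≤ depth v → (∀ w → ¬ Child v w) → IsLeaf v
    childless-leaf v 1≤d childless =
      trans (cong sum (map-tabulate {n = n} (λ w → w) (indicator (adj v))))
            (one-selected (adj v) (parent v) (Equivalence.to T-≡ (proj₁ (parent-spec v 1≤d))) only-parent)
      where
      only-parent : ∀ w → adj v w ≡ true → w ≡ parent v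
      only-parent w v~w with parent v ≟F w
      ... | yes pv≡w  = sym pv≡w
      ... | no  pv≢w = ⊥-elim (childless w (neighbour-is-child (Equivalence.from T-≡ v~w) 1≤d pv≢w))

    Below : V → V → Set
    Below v ℓ = IsLeaf ℓ × Σ ℕ λ m → m + depth v ≡ depth ℓ × ancestor m ℓ ≡ v

    walk-down : ℕ → V → V
    walk-down zero    v = v
    walk-down (suc k) v with any? (child? v)
    ... | yes (w , _) = walk-down k w
    ... | no _        = v

    -- Since depths are bounded by n, walking down n steps always ends at a leaf.
    walk-down-below : ∀ k v → 1 ≤ depth v → n ≤ depth v + k → Below v (walk-down k v)
    walk-down-below zero v 1≤d n≤d = childless-leaf v 1≤d childless , 0 , refl , refl
      where
      childless : ∀ w → ¬ Child v w
      childless w ch = <-irrefl refl (begin-strict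
        depth v      <⟨ n<1+n (depth v) ⟩
        suc (depth v) ≡⟨ sym (child-depth ch) ⟩
        depth w      ≤⟨ depth≤n w ⟩
        n            ≤⟨ n≤d ⟩
        depth v + 0  ≡⟨ +-identityʳ (depth v) ⟩
        depth v      ∎)
        where open ≤-Reasoning
    walk-down-below (suc k) v 1≤d n≤d with any? (child? v)
    ... | no none = childless-leaf v 1≤d (λ w ch → none (w , ch)) , 0 , refl , refl
    ... | yes (w , ch) with walk-down-below k w (proj₁ ch)
                              (≤-trans n≤d (≤-reflexive (trans (+-suc (depth v) k) (cong (_+ k) (sym (child-depth ch))))))
    ...   | (leaf , m , m+dw , up) =
      leaf , suc m , trans (sym (+-suc m (depth v))) (trans (cong (m +_) (sym (child-depth ch))) m+dw) ,
      trans (cong parent up) (proj₂ ch)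

    leafBelow : V → V
    leafBelow = walk-down n

    leafBelow-spec : ∀ v → 1 ≤ depth v → Below v (leafBelow v)
    leafBelow-spec v 1≤d = walk-down-below n v 1≤d (m≤n+m n (depth v))

    below-determined : ∀ {v w ℓ} → Below v ℓ → Below w ℓ → depth v ≡ depth w → v ≡ w
    below-determined {v} {w} {ℓ} (_ , m , m+dv , up) (_ , m' , m'+dw , up') same =
      trans (sym up) (trans (cong (λ k → ancestor k ℓ) m≡m') up')
      where
      m≡m' : m ≡ m'
      m≡m' = +-cancelʳ-≡ (depth v) m m' (trans m+dv (trans (sym m'+dw) (cong (m' +_) (sym same))))

    same-leafBelow : ∀ {v w} → v ≢ c → w ≢ c → leafBelow v ≡ leafBelow w → depth v ≡ depth w → v ≡ w
    same-leafBelow {v} {w} v≢c w≢c same-leaf =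
      below-determined (leafBelow-spec v (nonroot-depth v≢c))
                       (subst (Below w) (sym same-leaf) (leafBelow-spec w (nonroot-depth w≢c)))

    leafBelow∈leaves : ∀ {v} → v ≢ c → leafBelow v ∈ leaves
    leafBelow∈leaves v≢c = leaf∈leaves (proj₁ (leafBelow-spec _ (nonroot-depth v≢c)))

    branch : V → V
    branch v = ancestor (depth v ∸ 1) v

    branch-depth : ∀ {v} → 1 ≤ depth v → depth (branch v) ≡ 1
    branch-depth {v} 1≤d = +-cancelʳ-≡ (depth v ∸ 1) _ 1
      (trans (ancestor-depth (depth v ∸ 1) v (m∸n≤m (depth v) 1)) (sym (m+[n∸m]≡n 1≤d)))

    branch-of-depth-1 : ∀ {v} → depth v ≡ 1 → branch v ≡ v
    branch-of-depth-1 {v} d≡1 = cong (λ k → ancestor (k ∸ 1) v) d≡1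

    branch-ancestor : ∀ a v → a < depth v → branch (ancestor a v) ≡ branch v
    branch-ancestor a v a<d = begin
      ancestor (depth (ancestor a v) ∸ 1) (ancestor a v)  ≡⟨ sym (ancestor-+ (depth (ancestor a v) ∸ 1) a v) ⟩
      ancestor ((depth (ancestor a v) ∸ 1) + a) v        ≡⟨ cong (λ k → ancestor k v) levels ⟩
      ancestor (depth v ∸ 1) v                           ∎
      where
      open ≡-Reasoning
      a-up : depth (ancestor a v) + a ≡ depth v
      a-up = ancestor-depth a v (<⇒≤ a<d)
      levels : (depth (ancestor a v) ∸ 1) + a ≡ depth v ∸ 1
      levels = trans (sym (+-∸-comm a (+-cancelʳ-≤ a 1 _ (subst (suc a ≤_) (sym a-up) a<d)))) (cong (_∸ 1) a-up)

    same-leafBelow-branch : ∀ {v w} → v ≢ c → w ≢ c → leafBelow v ≡ leafBelow w → branch v ≡ branch w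
    same-leafBelow-branch {v} {w} v≢c w≢c same-leaf =
      trans (branch-of-leaf v v≢c) (trans (cong branch same-leaf) (sym (branch-of-leaf w w≢c)))
      where
      branch-of-leaf : ∀ u → u ≢ c → branch u ≡ branch (leafBelow u)
      branch-of-leaf u u≢c with leafBelow-spec u (nonroot-depth u≢c)
      ... | (_ , m , m+du , up) = trans (cong branch (sym up))
        (branch-ancestor m (leafBelow u) (subst (m <_) m+du (subst (_≤ m + depth u) (+-comm m 1) (+-monoʳ-≤ m (nonroot-depth u≢c)))))

    -- Central count: if all depths are ≤ h then n ≤ 1 + L·h, since each non-root
    -- vertex is determined by its leaf below and its depth ∈ [1, h].
    count-by-depth : ∀ h → (∀ v → depth v ≤ h) → n ≤ 1 + length leaves * h
    count-by-depth h bounded = count-by-pairs (c ∷ []) leaves h leafBelow (λ v → depth v ∸ 1) fits separated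
      where
      fits : ∀ v → v ∉ c ∷ [] → leafBelow v ∈ leaves × depth v ∸ 1 < h
      fits v v∉ = leafBelow∈leaves (v∉ ∘ here) , ∸-monoˡ-< (s≤s (bounded v)) (nonroot-depth (v∉ ∘ here))

      separated : ∀ v w → v ∉ c ∷ [] → w ∉ c ∷ [] → leafBelow v ≡ leafBelow w → depth v ∸ 1 ≡ depth w ∸ 1 → v ≡ w
      separated v w v∉ w∉ same-leaf levels = same-leafBelow (v∉ ∘ here) (w∉ ∘ here) same-leaf
        (∸-cancelʳ-≡ (nonroot-depth (v∉ ∘ here)) (nonroot-depth (w∉ ∘ here)) levels)

    -- Bicentral count: if all depths are ≤ R + 1 and only the branch of z reaches
    -- depth R + 1, then n ≤ 2 + L·R: apart from c and z, vertices in the branch of z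
    -- have depth ∈ [2, R + 1] and all others depth ∈ [1, R].
    count-split : ∀ R z → (∀ v → depth v ≤ suc R) → (∀ v → v ≢ c → branch v ≢ z → depth v ≤ R) →
                  n ≤ 2 + length leaves * R
    count-split R z bounded outside = count-by-pairs (c ∷ z ∷ []) leaves R leafBelow level fits separated
      where
      offset : V → ℕ
      offset b with b ≟F z
      ... | yes _ = 2
      ... | no _  = 1

      level : V → ℕ
      level v = depth v ∸ offset (branch v)

      range : ∀ v → v ≢ c → v ≢ z → offset (branch v) ≤ depth v × depth v < offset (branch v) + R
      range v v≢c v≢z with branch v ≟F z
      ... | yes bz = ≤∧≢⇒< (nonroot-depth v≢c) (λ 1≡d → v≢z (trans (sym (branch-of-depth-1 (sym 1≡d))) bz)) ,
                     s≤s (bounded v)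
      ... | no bz  = nonroot-depth v≢c , s≤s (outside v v≢c bz)

      fits : ∀ v → v ∉ c ∷ z ∷ [] → leafBelow v ∈ leaves × level v < R
      fits v v∉ with range v (v∉ ∘ here) (v∉ ∘ there ∘ here)
      ... | (low , high) = leafBelow∈leaves (v∉ ∘ here) ,
        subst (level v <_) (m+n∸m≡n (offset (branch v)) R) (∸-monoˡ-< high low)

      separated : ∀ v w → v ∉ c ∷ z ∷ [] → w ∉ c ∷ z ∷ [] → leafBelow v ≡ leafBelow w → level v ≡ level w → v ≡ w
      separated v w v∉ w∉ same-leaf levels = same-leafBelow (v∉ ∘ here) (w∉ ∘ here) same-leaf
        (∸-cancelʳ-≡ (subst (_≤ depth v) same-offset (proj₁ (range v (v∉ ∘ here) (v∉ ∘ there ∘ here))))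
                     (proj₁ (range w (w∉ ∘ here) (w∉ ∘ there ∘ here)))
                     (trans (cong (depth v ∸_) (sym same-offset)) levels))
        where
        same-offset : offset (branch v) ≡ offset (branch w)
        same-offset = cong offset (same-leafBelow-branch (v∉ ∘ here) (w∉ ∘ here) same-leaf)

    OffBranch : V → V → Set
    OffBranch z y = depth y ≡ 0 ⊎ branch y ≢ z

    off-branch? : ∀ z y → Dec (OffBranch z y)
    off-branch? z y = (depth y ≟ 0) ⊎-dec ¬? (branch y ≟F z)

    -- A vertex y outside the branch of x is reached from x through c, by a path
    -- of length depth x + depth y.
    across-path : ∀ x y → OffBranch (branch x) y → PathOfLength G (depth x + depth y) x y
    across-path x y off = subst₂ (PathOfLength G _) vee-start (vee-end top)
                            (Path⇒PathOfLength (vee-path ≤-refl ≤-refl top (disjoint off)))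
      where
      open Vee x y (depth x) (depth y)
      top : ancestor (depth x) x ≡ ancestor (depth y) y
      top = trans (ancestor-root x) (sym (ancestor-root y))
      disjoint : OffBranch (branch x) y → ∀ a b → a < depth x → b < depth y → ancestor a x ≢ ancestor b y
      disjoint (inj₁ dy≡0)     a b a<dx b<dy eq = <-irrefl refl (≤-trans b<dy (≤-trans (≤-reflexive dy≡0) z≤n))
      disjoint (inj₂ elsewhere) a b a<dx b<dy eq = elsewhere (begin
        branch y                ≡⟨ sym (branch-ancestor b y b<dy) ⟩
        branch (ancestor b y)   ≡⟨ cong branch (sym eq) ⟩
        branch (ancestor a x)   ≡⟨ branch-ancestor a x a<dx ⟩
        branch x                ∎)
        where open ≡-Reasoning

  module Reroot (c z : V) where
    private
      module C = Rooted c
      module Z = Rooted z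

    reroot-ancestor : ∀ k u → k ≤ C.depth u → Z.depth u ≤ Z.depth (C.ancestor k u) + k
    reroot-ancestor zero    u _   = ≤-reflexive (sym (+-identityʳ _))
    reroot-ancestor (suc k) u k<d = begin
      Z.depth u                                  ≤⟨ reroot-ancestor k u (≤-trans (n≤1+n k) k<d) ⟩
      Z.depth (C.ancestor k u) + k               ≤⟨ +-monoˡ-≤ k (Z.depth-~ (C.ancestor-~ k u k<d)) ⟩
      suc (Z.depth (C.ancestor (suc k) u)) + k   ≡⟨ sym (+-suc _ k) ⟩
      Z.depth (C.ancestor (suc k) u) + suc k     ∎
      where open ≤-Reasoning

    recentre : ∀ R → C.depth z ≡ 1 → (∀ v → C.depth v ≤ suc R) →
               (∀ v → C.OffBranch z v → C.depth v < R) → ∀ v → Z.depth v ≤ R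
    recentre R dz≡1 bounded shallow v with C.off-branch? z v
    ... | yes off = begin
      Z.depth v                                      ≤⟨ reroot-ancestor (C.depth v) v ≤-refl ⟩
      Z.depth (C.ancestor (C.depth v) v) + C.depth v ≡⟨ cong (λ u → Z.depth u + C.depth v) (C.ancestor-root v) ⟩
      Z.depth c + C.depth v                          ≤⟨ +-monoˡ-≤ (C.depth v) c-near-z ⟩
      suc (C.depth v)                                ≤⟨ shallow v off ⟩
      R                                              ∎
      where
      open ≤-Reasoning
      -- c is the parent of z, hence adjacent to it
      c-near-z : Z.depth c ≤ 1
      c-near-z with C.parent-spec z (≤-reflexive (sym dz≡1))
      ... | (z~pz , d-pz) = subst (λ u → Z.depth u ≤ 1) (C.depth≡0 (suc-injective (trans d-pz dz≡1)))
                              (subst (λ k → Z.depth (C.parent z) ≤ suc k) Z.depth-root (Z.depth-~ (~-sym z~pz)))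
    ... | no inside = begin
      Z.depth v                                ≤⟨ reroot-ancestor (C.depth v ∸ 1) v (m∸n≤m _ 1) ⟩
      Z.depth (C.branch v) + (C.depth v ∸ 1)   ≡⟨ cong (λ u → Z.depth u + (C.depth v ∸ 1)) in-z ⟩
      Z.depth z + (C.depth v ∸ 1)              ≡⟨ cong (_+ (C.depth v ∸ 1)) Z.depth-root ⟩
      C.depth v ∸ 1                            ≤⟨ ∸-monoˡ-≤ 1 (bounded v) ⟩
      R                                        ∎
      where
      open ≤-Reasoning
      in-z : C.branch v ≡ z
      in-z with C.branch v ≟F z
      ... | yes b≡z = b≡z
      ... | no b≢z  = ⊥-elim (inside (inj₂ b≢z))

  module Descent (d : ℕ) (diameter : ∀ k u v → PathOfLength G k u v → k ≤ d) (two-leaves : 2 ≤ numLeaves G) where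

    Goal : Set
    Goal = 2 * n ≤ numLeaves G * d + 2

    module Step (c : V) (R : ℕ) (bounded : ∀ v → Rooted.depth c v ≤ suc R)
                (x : V) (dx : Rooted.depth c x ≡ suc R) where
      open Rooted c

      z : V
      z = branch x

      through-c : ∀ {y k} → OffBranch z y → depth y ≡ k → suc R + k ≤ d
      through-c {y} off dy = subst (_≤ d) (cong₂ _+_ dx dy) (diameter _ _ _ (across-path x y off))

      step : Goal ⊎ ∃ λ z′ → ∀ v → Rooted.depth z′ v ≤ R
      step with any? (λ y → off-branch? z y ×-dec (depth y ≟ suc R))
      ... | yes (y , off , dy) = inj₁ (central-bound {L = numLeaves G} {h = suc R} (count-by-depth (suc R) bounded) (through-c off dy))
      ... | no no-far with any? (λ y → off-branch? z y ×-dec (depth y ≟ R))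
      ...   | yes (y , off , dy) = inj₁ (bicentral-bound {L = numLeaves G} {R = R} two-leaves (count-split R z bounded outside) (through-c off dy))
        where
        outside : ∀ v → v ≢ c → branch v ≢ z → depth v ≤ R
        outside v _ b≢z = ≤-pred (≤∧≢⇒< (bounded v) (λ dv → no-far (v , inj₂ b≢z , dv)))
      ...   | no no-mid = inj₂ (z , Reroot.recentre c z R (branch-depth (subst (1 ≤_) (sym dx) (s≤s z≤n))) bounded shallow)
        where
        shallow : ∀ v → OffBranch z v → depth v < R
        shallow v off = ≤∧≢⇒< (≤-pred (≤∧≢⇒< (bounded v) (λ dv → no-far (v , off , dv)))) (λ dv → no-mid (v , off , dv))

    -- Induction on an eccentricity bound R of the current root; for R = 0 the tree is
    -- the single vertex c.
    descend : ∀ R c → (∀ v → Rooted.depth c v ≤ R) → Goal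
    descend zero    c bounded = central-bound {L = numLeaves G} {h = 0} (Rooted.count-by-depth c 0 bounded) z≤n
    descend (suc R) c bounded with any? (λ x → Rooted.depth c x ≟ suc R)
    ... | no none      = descend R c (λ v → ≤-pred (≤∧≢⇒< (bounded v) (λ dv → none (v , dv))))
    ... | yes (x , dx) with Step.step c R bounded x dx
    ...   | inj₁ done             = done
    ...   | inj₂ (z , bounded-z)  = descend R z bounded-z

    bound : V → Goal
    bound c = descend n c (Rooted.depth≤n c)

-- The empty graph is trivial; otherwise descend from vertex 0, using only the upper
-- bound half of the diameter hypothesis.
lemma8 : (n : ℕ) (G : SimpleGraph n) (s d : ℕ) → IsTree G → numLeaves G ≡ s → 2 ≤ s →
         HasDiameter G d → 2 * n ≤ s * d + 2
lemma8 zero    G s d _                 _    _   _            = z≤n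
lemma8 (suc n) G s d (conn , acyclic) refl 2≤s (_ , longest) =
  Tree.Descent.bound G conn acyclic d longest 2≤s zero
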